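{- Let $G^*$ be the graph with vertex set $\{1,\dots,9\}$ and the $14$ edges $\{i,i+1\}$ for $1\le i\le 8$, $\{9,1\}$, $\{1,6\}$, $\{2,5\}$, $\{3,7\}$, $\{4,9\}$, $\{5,8\}$. Then $\overline{L(G^*)}$ is equistable but not strongly equistable.
   Context: $L(G)$ is the line graph of $G$ and $\overline{H}$ the complement of $H$. A graph $H$ is equistable if there is $\varphi:V(H)\to\mathbb{R}_{>0}$ such that for all $S\subseteq V(H)$, $S$ is a maximal stable set iff $\varphi(S):=\sum_{v\in S}\varphi(v)=1$. Let $\mathcal{S}(H)$ be the set of maximal stable sets of $H$ and $\mathcal{T}(H)$ the set of all other nonempty subsets of $V(H)$; $H$ is strongly equistable if for each $T\in\mathcal{T}(H)$ and each real $\gamma\le 1$ there is $\varphi:V(H)\to\mathbb{R}_{>0}$ with $\varphi(S)=1$ for all $S\in\mathcal{S}(H)$ and $\varphi(T)\ne\gamma$.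
   Formalization: The weightings φ take values in the positive rationals rather than $\mathbb{R}_{>0}$, and the parameter γ is taken over the rationals rather than the reals. -}

module Defs where

open import Data.Nat using (ℕ)
open import Data.Fin using (Fin; #_)
open import Data.Fin.Subset using (Subset; _∈_; _∉_; _⊆_; Nonempty)
open import Data.Vec using (Vec; []; _∷_; lookup)
open import Data.List using (List; foldr; map)
open import Data.List.Base using ()
open import Data.Fin using (zero; suc)
open import Data.Bool using (true; false)
open import Data.Product using (_×_; _,_; Σ; ∃)
open import Data.Sum using (_⊎_)
open import Relation.Binary.PropositionalEquality using (_≡_; _≢_)
open import Relation.Nullary using (¬_)
open import Data.Rational using (ℚ; 0ℚ; 1ℚ; _+_; _<_; _≤_)
open import Function.Bundles using (_⇔_)

record Graph : Set₁ where
  field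
    size : ℕ
    Adj  : Fin size → Fin size → Set
open Graph public

record EdgeGraph : Set where
  field
    n     : ℕ
    m     : ℕ
    edges : Vec (Fin n × Fin n) m
open EdgeGraph public

ShareEnd : ∀ {n} → Fin n × Fin n → Fin n × Fin n → Set
ShareEnd (a , b) (c , d) = (a ≡ c) ⊎ (a ≡ d) ⊎ (b ≡ c) ⊎ (b ≡ d)

L : EdgeGraph → Graph
L G = record { size = m G
             ; Adj = λ i j → (i ≢ j) × ShareEnd (lookup (edges G) i) (lookup (edges G) j) }

complement : Graph → Graph
complement H = record { size = size H ; Adj = λ u v → (u ≢ v) × ¬ Adj H u v }

Stable : (H : Graph) → Subset (size H) → Set
Stable H S = ∀ u v → u ∈ S → v ∈ S → ¬ Adj H u v

MaximalStable : (H : Graph) → Subset (size H) → Set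
MaximalStable H S = Stable H S × (∀ T → S ⊆ T → Stable H T → T ⊆ S)

weight : ∀ {n} → (Fin n → ℚ) → Subset n → ℚ
weight {ℕ.zero} φ [] = 0ℚ
weight {ℕ.suc k} φ (true ∷ S) = φ zero + weight (λ i → φ (suc i)) S
weight {ℕ.suc k} φ (false ∷ S) = weight (λ i → φ (suc i)) S

Positive : ∀ {n} → (Fin n → ℚ) → Set
Positive φ = ∀ v → 0ℚ < φ v

Equistable : Graph → Set
Equistable H = Σ (Fin (size H) → ℚ) λ φ → Positive φ ×
  (∀ S → MaximalStable H S ⇔ (weight φ S ≡ 1ℚ))

StronglyEquistable : Graph → Set
StronglyEquistable H = ∀ (T : Subset (size H)) → Nonempty T → ¬ MaximalStable H T →
  ∀ (γ : ℚ) → γ ≤ 1ℚ →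
  Σ (Fin (size H) → ℚ) λ φ → Positive φ ×
    (∀ S → MaximalStable H S → weight φ S ≡ 1ℚ) × (weight φ T ≢ γ)

-- G*: vertex i of the paper is # (i - 1).
G* : EdgeGraph
G* = record { n = 9 ; m = 14 ; edges =
    (# 0 , # 1) ∷ (# 1 , # 2) ∷ (# 2 , # 3) ∷ (# 3 , # 4) ∷ (# 4 , # 5) ∷
    (# 5 , # 6) ∷ (# 6 , # 7) ∷ (# 7 , # 8) ∷ (# 8 , # 0) ∷
    (# 0 , # 5) ∷ (# 1 , # 4) ∷ (# 2 , # 6) ∷ (# 3 , # 8) ∷ (# 4 , # 7) ∷ [] }

{-# OPTIONS --safe #-}
module Submission where

-- G* is triangle-free and every vertex w has, for each edge x not at w, an edge at w disjoint
-- from x.  Hence the maximal stable sets of the complement of L(G*), i.e. the maximal sets of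
-- pairwise meeting edges, are exactly the nine vertex stars.  Equistability is witnessed by
-- integer edge weights for which every star sums to 5000 while, by exhaustive search over all
-- 2^14 edge sets, no other set does.  Against strong equistability, let T consist of the edges
-- {9,1} and {3,7}.  Adding the stars at 1, 3, 5, 7, 9 and subtracting those at 2, 4, 6, 8
-- cancels every edge between odd and even vertices; T is the set of edges joining two odd
-- vertices and no edge joins two even ones, so what remains is twice T.  Hence every φ with
-- φ(S) = 1 on all maximal stable sets has 2 φ(T) = 5 - 4, i.e. φ(T) = ½, although T is not
-- even stable.

open import Defs
open import Data.Product using (_×_)
open import Relation.Nullary using (¬_)

open import Algebra.Bundles using (CommutativeMonoid)
open import Data.Bool using (true; false; if_then_else_)
import Data.Bool.Properties as Bool
open import Data.Empty using (⊥-elim)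
open import Data.Fin using (Fin; zero; suc; #_; _≟_)
open import Data.Fin.Properties using (all?; any?)
open import Data.Fin.Subset using (Subset; _∈_; _∉_; _⊆_; Nonempty; ⁅_⁆; _∪_)
open import Data.Fin.Subset.Properties
  using (_∈?_; nonempty?; ⊆-antisym; x∈⁅x⁆; x∈⁅y⁆⇒x≡y; x∈p∪q⁺; anySubset?)
import Data.Integer as ℤ
import Data.Integer.Properties as ℤ
open import Data.Integer.Tactic.RingSolver using (solve-∀)
open import Data.List using (List; []; _∷_; map; foldr; length)
open import Data.Nat as ℕ using (ℕ)
open import Data.Product using (_,_; ∃; ∄; proj₁; proj₂)
open import Data.Rational using (ℚ; 0ℚ; 1ℚ; ½; _+_; _*_; _-_; 1/_; ↥_; +-0-rawMonoid)
open import Data.Rational.Literals using (fromℤ)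
open import Data.Rational.Properties
  using (toℚᵘ-injective; toℚᵘ-homo-+; +-identityˡ; *-zeroʳ; *-distribˡ-+; *-assoc; *-identityˡ;
         *-identityʳ; *-inverseˡ; *-inverseʳ; _<?_; _≤?_; +-0-commutativeMonoid)
open import Data.Rational.Solver using (module +-*-Solver)
import Data.Rational.Unnormalised as ℚᵘ
import Data.Rational.Unnormalised.Properties as ℚᵘ
open import Data.Sum using (_⊎_; inj₁; inj₂; [_,_]′)
open import Data.Vec using ([]; _∷_; lookup; tabulate; tail)
open import Data.Vec.Properties using (lookup∘tabulate; lookup⇒[]=; []=⇒lookup)
import Data.Vec.Properties as Vec
open import Function using (_∘_; _⇔_; mk⇔; Equivalence)
import Function.Properties.Equivalence as ⇔
open import Relation.Binary.PropositionalEquality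
  using (_≡_; _≗_; refl; sym; trans; cong; cong₂; module ≡-Reasoning)
open import Relation.Nullary using (Dec; yes; no; does)
open import Relation.Nullary.Decidable
  using (dec-true; decidable-stable; from-yes; from-no; _×-dec_; _⊎-dec_; _→-dec_; ¬?)
open import Relation.Unary using (Pred; Decidable)

open import Algebra.Definitions.RawMonoid +-0-rawMonoid using () renaming (_×_ to _·_)
open import Algebra.Properties.CommutativeSemigroup
  (CommutativeMonoid.commutativeSemigroup +-0-commutativeMonoid) using (interchange; x∙yz≈y∙xz)

open ≡-Reasoning

dec-true⁻ : ∀ {A : Set} (a? : Dec A) → does a? ≡ true → A
dec-true⁻ (yes a) _ = a

∈-tabulate⇔ : ∀ {k} {P : Pred (Fin k) _} (P? : Decidable P) {x} → x ∈ tabulate (does ∘ P?) ⇔ P x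
∈-tabulate⇔ P? {x} = mk⇔
  (λ x∈ → dec-true⁻ (P? x) (trans (sym (lookup∘tabulate _ x)) ([]=⇒lookup x∈)))
  (λ Px → lookup⇒[]= x _ (trans (lookup∘tabulate _ x) (dec-true (P? x) Px)))

⊆⊎∃∉ : ∀ {k} (S T : Subset k) → S ⊆ T ⊎ ∃ λ x → x ∈ S × x ∉ T
⊆⊎∃∉ S T with any? (λ x → x ∈? S ×-dec ¬? (x ∈? T))
... | yes escape = inj₂ escape
... | no none    = inj₁ λ {x} x∈S → decidable-stable (x ∈? T) λ x∉T → none (x , x∈S , x∉T)

complement-irreflexive : ∀ H v → ¬ Adj (complement H) v v
complement-irreflexive H v (v≢v , _) = v≢v refl

maximalStable-nonempty : ∀ H → (∀ v → ¬ Adj H v v) → Fin (size H) →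
                         ∀ {S} → MaximalStable H S → Nonempty S
maximalStable-nonempty H irreflexive v {S} (_ , maximal) with nonempty? S
... | yes nonempty = nonempty
... | no empty     = v , maximal ⁅ v ⁆ (λ x∈S → ⊥-elim (empty (_ , x∈S))) singleton-stable (x∈⁅x⁆ v)
  where
  singleton-stable : Stable H ⁅ v ⁆
  singleton-stable x y x∈ y∈ rewrite x∈⁅y⁆⇒x≡y v x∈ | x∈⁅y⁆⇒x≡y v y∈ = irreflexive v

_∈ₑ_ : ∀ {k} → Fin k → Fin k × Fin k → Set
w ∈ₑ (a , b) = w ≡ a ⊎ w ≡ b

_∈ₑ?_ : ∀ {k} (w : Fin k) e → Dec (w ∈ₑ e)
w ∈ₑ? (a , b) = (w ≟ a) ⊎-dec (w ≟ b)

shareEnd? : ∀ {k} (e f : Fin k × Fin k) → Dec (ShareEnd e f)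
shareEnd? (a , b) (c , d) = (a ≟ c) ⊎-dec (a ≟ d) ⊎-dec (b ≟ c) ⊎-dec (b ≟ d)

shareEnd : ∀ {k} {w : Fin k} e f → w ∈ₑ e → w ∈ₑ f → ShareEnd e f
shareEnd _ _ (inj₁ refl) (inj₁ refl) = inj₁ refl
shareEnd _ _ (inj₁ refl) (inj₂ refl) = inj₂ (inj₁ refl)
shareEnd _ _ (inj₂ refl) (inj₁ refl) = inj₂ (inj₂ (inj₁ refl))
shareEnd _ _ (inj₂ refl) (inj₂ refl) = inj₂ (inj₂ (inj₂ refl))

edge : (G : EdgeGraph) → Fin (m G) → Fin (n G) × Fin (n G)
edge G = lookup (edges G)

star : (G : EdgeGraph) → Fin (n G) → Subset (m G)
star G w = tabulate (does ∘ λ x → w ∈ₑ? edge G x)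

-- For a graph without loops this says that there is no triangle.
ThreeMeetingEdgesShareEnd : EdgeGraph → Set
ThreeMeetingEdgesShareEnd G = ∀ a b c →
  ShareEnd (edge G a) (edge G b) → ShareEnd (edge G a) (edge G c) → ShareEnd (edge G b) (edge G c) →
  ∃ λ w → w ∈ₑ edge G a × w ∈ₑ edge G b × w ∈ₑ edge G c

StarsAvoidOutsideEdges : EdgeGraph → Set
StarsAvoidOutsideEdges G = ∀ w x → ¬ w ∈ₑ edge G x →
  ∃ λ u → w ∈ₑ edge G u × ¬ ShareEnd (edge G u) (edge G x)

module _ (G : EdgeGraph) where

  private
    H : Graph
    H = complement (L G)

  ∈-star⇔ : ∀ w {x} → x ∈ star G w ⇔ w ∈ₑ edge G x
  ∈-star⇔ w = ∈-tabulate⇔ λ x → w ∈ₑ? edge G x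

  ∈-star⁺ : ∀ w {x} → w ∈ₑ edge G x → x ∈ star G w
  ∈-star⁺ w = Equivalence.from (∈-star⇔ w)

  ∈-star⁻ : ∀ w {x} → x ∈ star G w → w ∈ₑ edge G x
  ∈-star⁻ w = Equivalence.to (∈-star⇔ w)

  ¬adj⇒shareEnd : ∀ {x y} → ¬ Adj H x y → ShareEnd (edge G x) (edge G y)
  ¬adj⇒shareEnd {x} {y} ¬adj with x ≟ y
  ... | yes refl = inj₁ refl
  ... | no x≢y   = decidable-stable (shareEnd? _ _) λ ¬share → ¬adj (x≢y , λ (_ , share) → ¬share share)

  ¬shareEnd⇒adj : ∀ {x y} → ¬ ShareEnd (edge G x) (edge G y) → Adj H x y
  ¬shareEnd⇒adj ¬share = (λ { refl → ¬share (inj₁ refl) }) , λ (_ , share) → ¬share share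

  stable⇒shareEnd : ∀ {S} → Stable H S → ∀ {x y} → x ∈ S → y ∈ S → ShareEnd (edge G x) (edge G y)
  stable⇒shareEnd stable x∈S y∈S = ¬adj⇒shareEnd (stable _ _ x∈S y∈S)

  star-stable : ∀ w → Stable H (star G w)
  star-stable w x y x∈ y∈ (x≢y , ¬meet) = ¬meet (x≢y , shareEnd _ _ (∈-star⁻ w x∈) (∈-star⁻ w y∈))

  star-maximalStable : StarsAvoidOutsideEdges G → ∀ w → MaximalStable H (star G w)
  star-maximalStable avoid w = star-stable w , stable⇒⊆star
    where
    stable⇒⊆star : ∀ T → star G w ⊆ T → Stable H T → T ⊆ star G w
    stable⇒⊆star T star⊆T stable {x} x∈T with w ∈ₑ? edge G x
    ... | yes w∈x = ∈-star⁺ w w∈x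
    ... | no w∉x  with avoid w x w∉x
    ...   | u , w∈u , ¬share = ⊥-elim (stable u x (star⊆T (∈-star⁺ w w∈u)) x∈T (¬shareEnd⇒adj ¬share))

  stable-triple-ends : ThreeMeetingEdgesShareEnd G → ∀ {S} → Stable H S → ∀ {a b c} → a ∈ S → b ∈ S → c ∈ S →
                       proj₁ (edge G a) ∈ₑ edge G b ⊎ proj₂ (edge G a) ∈ₑ edge G c
  stable-triple-ends meet {S} stable {a} {b} {c} a∈S b∈S c∈S =
    commonEnd-at-a (meet a b c (meets a∈S b∈S) (meets a∈S c∈S) (meets b∈S c∈S))
    where
    meets : ∀ {x y} → x ∈ S → y ∈ S → ShareEnd (edge G x) (edge G y)
    meets = stable⇒shareEnd stable
    commonEnd-at-a : (∃ λ w → w ∈ₑ edge G a × w ∈ₑ edge G b × w ∈ₑ edge G c) →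
                     proj₁ (edge G a) ∈ₑ edge G b ⊎ proj₂ (edge G a) ∈ₑ edge G c
    commonEnd-at-a (_ , inj₁ refl , w∈b , _) = inj₁ w∈b
    commonEnd-at-a (_ , inj₂ refl , _ , w∈c) = inj₂ w∈c

  stable⊆star : ThreeMeetingEdgesShareEnd G → ∀ {S} → Stable H S → Nonempty S → ∃ λ w → S ⊆ star G w
  stable⊆star meet {S} stable (a , a∈S)
    with ⊆⊎∃∉ S (star G (proj₁ (edge G a))) | ⊆⊎∃∉ S (star G (proj₂ (edge G a)))
  ... | inj₁ S⊆star | _           = proj₁ (edge G a) , S⊆star
  ... | inj₂ _      | inj₁ S⊆star = proj₂ (edge G a) , S⊆star
  ... | inj₂ (b , b∈S , b∉star) | inj₂ (c , c∈S , c∉star) =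
    ⊥-elim ([ b∉star ∘ ∈-star⁺ _ , c∉star ∘ ∈-star⁺ _ ]′ (stable-triple-ends meet stable a∈S b∈S c∈S))

  maximalStable⇔star : ThreeMeetingEdgesShareEnd G → StarsAvoidOutsideEdges G → Fin (m G) →
                       ∀ S → MaximalStable H S ⇔ ∃ λ w → S ≡ star G w
  maximalStable⇔star meet avoid e S = mk⇔ maximal⇒star star⇒maximal
    where
    maximal⇒star : MaximalStable H S → ∃ λ w → S ≡ star G w
    maximal⇒star maximalS@(stable , maximal)
      with stable⊆star meet stable (maximalStable-nonempty H (complement-irreflexive (L G)) e maximalS)
    ... | w , S⊆star = w , ⊆-antisym S⊆star (maximal (star G w) S⊆star (star-stable w))
    star⇒maximal : (∃ λ w → S ≡ star G w) → MaximalStable H S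
    star⇒maximal (w , refl) = star-maximalStable avoid w

fromℕ : ℕ → ℚ
fromℕ k = fromℤ (ℤ.+ k)

fromℤ-+ : ∀ p q → fromℤ (p ℤ.+ q) ≡ fromℤ p + fromℤ q
fromℤ-+ p q = toℚᵘ-injective (ℚᵘ.≃-trans (ℚᵘ.*≡* (cross-multiplied p q)) (ℚᵘ.≃-sym (toℚᵘ-homo-+ (fromℤ p) (fromℤ q))))
  where
  cross-multiplied : ∀ p q → (p ℤ.+ q) ℤ.* (ℤ.+ 1 ℤ.* ℤ.+ 1) ≡ (p ℤ.* ℤ.+ 1 ℤ.+ q ℤ.* ℤ.+ 1) ℤ.* ℤ.+ 1
  cross-multiplied = solve-∀

fromℕ-injective : ∀ {j k} → fromℕ j ≡ fromℕ k → j ≡ k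
fromℕ-injective = ℤ.+-injective ∘ cong ↥_

sumℕ : ∀ {k} → (Fin k → ℕ) → Subset k → ℕ
sumℕ {ℕ.zero}  g []          = 0
sumℕ {ℕ.suc k} g (true ∷ S)  = g zero ℕ.+ sumℕ (g ∘ suc) S
sumℕ {ℕ.suc k} g (false ∷ S) = sumℕ (g ∘ suc) S

weight-fromℕ : ∀ {k} (g : Fin k → ℕ) S → weight (fromℕ ∘ g) S ≡ fromℕ (sumℕ g S)
weight-fromℕ g []          = refl
weight-fromℕ g (true ∷ S)  = trans (cong (fromℕ (g zero) +_) (weight-fromℕ (g ∘ suc) S))
                                   (sym (fromℤ-+ (ℤ.+ g zero) (ℤ.+ sumℕ (g ∘ suc) S)))
weight-fromℕ g (false ∷ S) = weight-fromℕ (g ∘ suc) S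

weight-*ˡ : ∀ {k} q (φ : Fin k → ℚ) S → weight (λ i → q * φ i) S ≡ q * weight φ S
weight-*ˡ q φ []          = sym (*-zeroʳ q)
weight-*ˡ q φ (true ∷ S)  = trans (cong (q * φ zero +_) (weight-*ˡ q (φ ∘ suc) S))
                                  (sym (*-distribˡ-+ q (φ zero) (weight (φ ∘ suc) S)))
weight-*ˡ q φ (false ∷ S) = weight-*ˡ q (φ ∘ suc) S

1/d*k≡1⇒k≡d : ∀ d .{{_ : ℕ.NonZero d}} k → 1/ fromℕ d * fromℕ k ≡ 1ℚ → k ≡ d
1/d*k≡1⇒k≡d d k ≡1 = fromℕ-injective (begin
  fromℕ k                          ≡⟨ sym (*-identityˡ (fromℕ k)) ⟩
  1ℚ * fromℕ k                     ≡⟨ cong (_* fromℕ k) (sym (*-inverseʳ (fromℕ d))) ⟩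
  fromℕ d * 1/ fromℕ d * fromℕ k   ≡⟨ *-assoc (fromℕ d) (1/ fromℕ d) (fromℕ k) ⟩
  fromℕ d * (1/ fromℕ d * fromℕ k) ≡⟨ cong (fromℕ d *_) ≡1 ⟩
  fromℕ d * 1ℚ                     ≡⟨ *-identityʳ (fromℕ d) ⟩
  fromℕ d                          ∎)

y+[y+c]≡1+c⇒y≡½ : ∀ {y c} → y + (y + c) ≡ 1ℚ + c → y ≡ ½
y+[y+c]≡1+c⇒y≡½ {y} {c} ≡1+c = begin
  y                        ≡⟨ solve 2 (λ y c → y := con ½ :* ((y :+ (y :+ c)) :- c)) refl y c ⟩
  ½ * ((y + (y + c)) - c) ≡⟨ cong (λ r → ½ * (r - c)) ≡1+c ⟩
  ½ * ((1ℚ + c) - c)      ≡⟨ solve 1 (λ c → con ½ :* ((con 1ℚ :+ c) :- c) := con ½) refl c ⟩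
  ½                        ∎
  where open +-*-Solver

weights : ∀ {k} → (Fin k → ℚ) → List (Subset k) → ℚ
weights φ = foldr (λ S → weight φ S +_) 0ℚ

multiplicity : ∀ {k} → List (Subset k) → Fin k → ℕ
multiplicity []       x = 0
multiplicity (S ∷ Ss) x = if lookup S x then ℕ.suc (multiplicity Ss x) else multiplicity Ss x

multiplicity-tail : ∀ {k} (Ss : List (Subset (ℕ.suc k))) x →
                    multiplicity (map tail Ss) x ≡ multiplicity Ss (suc x)
multiplicity-tail []             x = refl
multiplicity-tail ((_ ∷ S) ∷ Ss) x =
  cong (λ r → if lookup S x then ℕ.suc r else r) (multiplicity-tail Ss x)

weights-empty : (φ : Fin 0 → ℚ) (Ss : List (Subset 0)) → weights φ Ss ≡ 0ℚ
weights-empty φ []       = refl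
weights-empty φ ([] ∷ Ss) = trans (+-identityˡ (weights φ Ss)) (weights-empty φ Ss)

weights-suc : ∀ {k} (φ : Fin (ℕ.suc k) → ℚ) Ss →
              weights φ Ss ≡ multiplicity Ss zero · φ zero + weights (φ ∘ suc) (map tail Ss)
weights-suc φ []                 = refl
weights-suc φ ((true ∷ S) ∷ Ss)  =
  trans (cong (φ zero + weight (φ ∘ suc) S +_) (weights-suc φ Ss))
        (interchange (φ zero) (weight (φ ∘ suc) S) (multiplicity Ss zero · φ zero) (weights (φ ∘ suc) (map tail Ss)))
weights-suc φ ((false ∷ S) ∷ Ss) =
  trans (cong (weight (φ ∘ suc) S +_) (weights-suc φ Ss))
        (x∙yz≈y∙xz (weight (φ ∘ suc) S) (multiplicity Ss zero · φ zero) (weights (φ ∘ suc) (map tail Ss)))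

multiplicity-≗⇒weights-≡ : ∀ {k} (φ : Fin k → ℚ) Ss Ts → multiplicity Ss ≗ multiplicity Ts →
                           weights φ Ss ≡ weights φ Ts
multiplicity-≗⇒weights-≡ {ℕ.zero}  φ Ss Ts _    = trans (weights-empty φ Ss) (sym (weights-empty φ Ts))
multiplicity-≗⇒weights-≡ {ℕ.suc k} φ Ss Ts same = begin
  weights φ Ss                                                    ≡⟨ weights-suc φ Ss ⟩
  multiplicity Ss zero · φ zero + weights (φ ∘ suc) (map tail Ss) ≡⟨ cong₂ _+_ (cong (_· φ zero) (same zero)) tails ⟩
  multiplicity Ts zero · φ zero + weights (φ ∘ suc) (map tail Ts) ≡⟨ weights-suc φ Ts ⟨
  weights φ Ts                                                    ∎
  where
  same-tails : multiplicity (map tail Ss) ≗ multiplicity (map tail Ts)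
  same-tails x = trans (multiplicity-tail Ss x) (trans (same (suc x)) (sym (multiplicity-tail Ts x)))
  tails : weights (φ ∘ suc) (map tail Ss) ≡ weights (φ ∘ suc) (map tail Ts)
  tails = multiplicity-≗⇒weights-≡ (φ ∘ suc) (map tail Ss) (map tail Ts) same-tails

weights-map-const : ∀ {A : Set} {k} (φ : Fin k → ℚ) (f : A → Subset k) {q} →
                    (∀ a → weight φ (f a) ≡ q) → ∀ as → weights φ (map f as) ≡ length as · q
weights-map-const φ f const []       = refl
weights-map-const φ f const (a ∷ as) = cong₂ _+_ (const a) (weights-map-const φ f const as)

G*-threeMeetingEdgesShareEnd : ThreeMeetingEdgesShareEnd G*
G*-threeMeetingEdgesShareEnd = from-yes (all? λ a → all? λ b → all? λ c →
  shareEnd? (edge G* a) (edge G* b) →-dec shareEnd? (edge G* a) (edge G* c) →-dec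
  shareEnd? (edge G* b) (edge G* c) →-dec
  any? (λ w → w ∈ₑ? edge G* a ×-dec w ∈ₑ? edge G* b ×-dec w ∈ₑ? edge G* c))

G*-starsAvoidOutsideEdges : StarsAvoidOutsideEdges G*
G*-starsAvoidOutsideEdges = from-yes (all? λ w → all? λ x → ¬? (w ∈ₑ? edge G* x) →-dec
  any? (λ u → w ∈ₑ? edge G* u ×-dec ¬? (shareEnd? (edge G* u) (edge G* x))))

G*-maximalStable⇔star : ∀ S → MaximalStable (complement (L G*)) S ⇔ ∃ λ w → S ≡ star G* w
G*-maximalStable⇔star = maximalStable⇔star G* G*-threeMeetingEdgesShareEnd G*-starsAvoidOutsideEdges zero

G*-edgeWeight : Fin 14 → ℕ
G*-edgeWeight = lookup (1419 ∷ 1204 ∷ 1988 ∷ 139 ∷ 205 ∷ 1906 ∷ 1286 ∷ 1435 ∷ 692 ∷ 2889 ∷ 2377 ∷ 1808 ∷ 2873 ∷ 2279 ∷ [])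

G*-star-sumℕ : ∀ w → sumℕ G*-edgeWeight (star G* w) ≡ 5000
G*-star-sumℕ = from-yes (all? λ w → sumℕ G*-edgeWeight (star G* w) ℕ.≟ 5000)

G*-sumℕ⇒star : ∀ S → sumℕ G*-edgeWeight S ≡ 5000 → ∃ λ w → S ≡ star G* w
G*-sumℕ⇒star S ≡5000 = decidable-stable (star? S) λ notStar → noOtherSet (S , ≡5000 , notStar)
  where
  star? : ∀ S → Dec (∃ λ w → S ≡ star G* w)
  star? S = any? λ w → Vec.≡-dec Bool._≟_ S (star G* w)
  noOtherSet : ∄ λ S → sumℕ G*-edgeWeight S ≡ 5000 × ¬ ∃ λ w → S ≡ star G* w
  noOtherSet = from-no (anySubset? λ S → sumℕ G*-edgeWeight S ℕ.≟ 5000 ×-dec ¬? (star? S))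

φ* : Fin 14 → ℚ
φ* e = 1/ fromℕ 5000 * fromℕ (G*-edgeWeight e)

φ*-positive : Positive φ*
φ*-positive = from-yes (all? λ e → 0ℚ <? φ* e)

weight-φ* : ∀ S → weight φ* S ≡ 1/ fromℕ 5000 * fromℕ (sumℕ G*-edgeWeight S)
weight-φ* S = trans (weight-*ˡ (1/ fromℕ 5000) _ S) (cong (1/ fromℕ 5000 *_) (weight-fromℕ _ S))

weight-φ*≡1⇔star : ∀ S → weight φ* S ≡ 1ℚ ⇔ ∃ λ w → S ≡ star G* w
weight-φ*≡1⇔star S = mk⇔
  (λ ≡1 → G*-sumℕ⇒star S (1/d*k≡1⇒k≡d 5000 _ (trans (sym (weight-φ* S)) ≡1)))
  (λ { (w , refl) → begin
    weight φ* (star G* w)                                   ≡⟨ weight-φ* (star G* w) ⟩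
    1/ fromℕ 5000 * fromℕ (sumℕ G*-edgeWeight (star G* w)) ≡⟨ cong (λ k → 1/ fromℕ 5000 * fromℕ k)
                                                                    (G*-star-sumℕ w) ⟩
    1/ fromℕ 5000 * fromℕ 5000                              ≡⟨ *-inverseˡ (fromℕ 5000) ⟩
    1ℚ                                                      ∎ })

equistable : Equistable (complement (L G*))
equistable = φ* , φ*-positive , λ S → ⇔.trans (G*-maximalStable⇔star S) (⇔.sym (weight-φ*≡1⇔star S))

-- The paper's edges {9,1} and {3,7}.
T* : Subset 14
T* = ⁅ # 8 ⁆ ∪ ⁅ # 11 ⁆

#8∈T* : # 8 ∈ T*
#8∈T* = x∈p∪q⁺ {p = ⁅ # 8 ⁆} {q = ⁅ # 11 ⁆} (inj₁ (x∈⁅x⁆ (# 8)))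

#11∈T* : # 11 ∈ T*
#11∈T* = x∈p∪q⁺ {p = ⁅ # 8 ⁆} {q = ⁅ # 11 ⁆} (inj₂ (x∈⁅x⁆ (# 11)))

T*-unstable : ¬ Stable (complement (L G*)) T*
T*-unstable stable = stable (# 8) (# 11) #8∈T* #11∈T*
  (¬shareEnd⇒adj G* (from-no (shareEnd? (edge G* (# 8)) (edge G* (# 11)))))

-- Indices are 0-based: these are the paper's odd and even vertices, respectively.
evenVertices oddVertices : List (Fin 9)
evenVertices = # 0 ∷ # 2 ∷ # 4 ∷ # 6 ∷ # 8 ∷ []
oddVertices  = # 1 ∷ # 3 ∷ # 5 ∷ # 7 ∷ []

T*-doubleCounting : multiplicity (T* ∷ T* ∷ map (star G*) oddVertices) ≗ multiplicity (map (star G*) evenVertices)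
T*-doubleCounting = from-yes (all? λ e →
  multiplicity (T* ∷ T* ∷ map (star G*) oddVertices) e ℕ.≟ multiplicity (map (star G*) evenVertices) e)

weight-T*≡½ : ∀ φ → (∀ w → weight φ (star G* w) ≡ 1ℚ) → weight φ T* ≡ ½
weight-T*≡½ φ stars≡1 = y+[y+c]≡1+c⇒y≡½ (begin
  weight φ T* + (weight φ T* + 4 · 1ℚ)            ≡⟨ cong (λ r → weight φ T* + (weight φ T* + r))
                                                         (starsWeigh oddVertices) ⟨
  weights φ (T* ∷ T* ∷ map (star G*) oddVertices) ≡⟨ multiplicity-≗⇒weights-≡ φ
                                                         (T* ∷ T* ∷ map (star G*) oddVertices)
                                                         (map (star G*) evenVertices) T*-doubleCounting ⟩
  weights φ (map (star G*) evenVertices)          ≡⟨ starsWeigh evenVertices ⟩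
  1ℚ + 4 · 1ℚ                                     ∎)
  where
  starsWeigh : ∀ vs → weights φ (map (star G*) vs) ≡ length vs · 1ℚ
  starsWeigh = weights-map-const φ (star G*) stars≡1

¬stronglyEquistable : ¬ StronglyEquistable (complement (L G*))
¬stronglyEquistable stronglyEquistable
  with stronglyEquistable T* (# 8 , #8∈T*) (T*-unstable ∘ proj₁) ½ (from-yes (½ ≤? 1ℚ))
... | φ , _ , maximal⇒≡1 , ≢½ =
  ≢½ (weight-T*≡½ φ λ w → maximal⇒≡1 (star G* w) (star-maximalStable G* G*-starsAvoidOutsideEdges w))

corollary12 : Equistable (complement (L G*)) × ¬ StronglyEquistable (complement (L G*))
corollary12 = equistable , ¬stronglyEquistable
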